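{- Let $p$ be a permutation and let $[p]=\{x : x \text{ is a Cayley permutation with } \mathfrak{st}(x)=p\}$. Let $\mathrm{Prim}[p]$ be the set of primitive modified ascent sequences that avoid every element of $[p]$, and let $\Omega(p)$ be the set of permutations in $\Omega$ that avoid $p$. Then standardization $\mathfrak{st}$ restricts to a length-preserving bijection from $\mathrm{Prim}[p]$ to $\Omega(p)$.
   Context: A Cayley permutation of length $n$ is a word $x=x_1\cdots x_n$ of positive integers whose set of values is $\{1,\dots,k\}$ for some $k\le n$; a permutation is a Cayley permutation with no repeated entries. A Cayley permutation $x$ contains a Cayley permutation $y=y_1\cdots y_k$ if there are indices $i_1<\cdots<i_k$ with $x_{i_s}<x_{i_t}\iff y_s<y_t$ and $x_{i_s}=x_{i_t}\iff y_s=y_t$ for all $s,t$; otherwise $x$ avoids $y$. The ascent tops of $x$ are the pairs $(1,x_1)$ and $(i,x_i)$ with $1<i\le n$ and $x_{i-1}<x_i$; the leftmost copies of $x$ are the pairs $(\min\{i:x_i=j\},j)$ for $1\le j\le\max(x)$. A modified ascent sequence is a Cayley permutation whose set of ascent tops equals its set of leftmost copies; it is primitive if it has no two consecutive equal entries. Standardization: if $x$ is a Cayley permutation and $a_i$ is the number of entries of $x$ equal to $i$, then $\mathfrak{st}(x)$ is the permutation obtained by replacing the $a_i$ copies of $i$, from left to right, by $a_1+\cdots+a_{i-1}+1,\dots,a_1+\cdots+a_{i-1}+a_i$. $\Omega$ is the set of permutations $p=p_1\cdots p_n$ (of any length $n\ge0$) such that either $n=0$ or $p_1=1$, and such that there are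 no indices $i,j$ with $i+1<j$, $p_i>p_{i+1}$ and $p_{i+1}=p_j+1$. -}

module Defs where

open import Data.Nat using (ℕ; zero; suc; _+_; _<_; _≤_; _>_; _<?_; _≟_)
open import Data.List using (List; []; _∷_; length; filter; _++_; [_])
open import Data.List.Membership.Propositional using (_∈_)
open import Data.List.Relation.Unary.Unique.Propositional using (Unique)
open import Data.List.Relation.Binary.Sublist.Propositional using (_⊆_)
open import Data.Product using (Σ; ∃; ∃-syntax; _×_)
open import Data.Sum using (_⊎_)
open import Relation.Nullary using (¬_)
open import Relation.Binary.PropositionalEquality using (_≡_)
open import Function.Bundles using (_⇔_)
open import Data.Unit using (⊤)

Word : Set
Word = List ℕ

-- 0-based entry lookup (default 0 out of range; only used in range).
nth : Word → ℕ → ℕ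
nth []       _       = 0
nth (v ∷ _)  zero    = v
nth (_ ∷ vs) (suc i) = nth vs i

IsCayley : Word → Set
IsCayley x = ∃[ k ] (k ≤ length x
  × (∀ i → i < length x → 1 ≤ nth x i × nth x i ≤ k)
  × (∀ v → 1 ≤ v → v ≤ k → v ∈ x))

IsPerm : Word → Set
IsPerm x = IsCayley x × Unique x

SamePattern : Word → Word → Set
SamePattern z y = length z ≡ length y
  × (∀ s t → s < length y → t < length y →
       (nth z s < nth z t ⇔ nth y s < nth y t)
     × (nth z s ≡ nth z t ⇔ nth y s ≡ nth y t))

Contains : Word → Word → Set
Contains x y = ∃[ z ] (z ⊆ x × SamePattern z y)

Avoids : Word → Word → Set
Avoids x y = ¬ Contains x y

AscentTopAt : Word → ℕ → Set
AscentTopAt x zero    = ⊤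
AscentTopAt x (suc i) = nth x i < nth x (suc i)

LeftmostCopyAt : Word → ℕ → Set
LeftmostCopyAt x i = ∀ j → j < i → ¬ (nth x j ≡ nth x i)

-- Modified ascent sequence: Cayley permutation whose set of ascent tops
-- equals its set of leftmost copies (both sets consist of pairs (i , x_i)).
IsModAsc : Word → Set
IsModAsc x = IsCayley x
  × (∀ i → i < length x → (AscentTopAt x i ⇔ LeftmostCopyAt x i))

IsPrimitive : Word → Set
IsPrimitive x = ∀ i → suc i < length x → ¬ (nth x i ≡ nth x (suc i))

-- The entry v at position k (being the c-th copy of v,
-- counted from the left) is replaced by a_1 + ... + a_{v-1} + c, where
-- a_1 + ... + a_{v-1} is the number of entries of x smaller than v.
countLess : ℕ → Word → ℕ
countLess v x = length (filter (_<? v) x)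

countEq : ℕ → Word → ℕ
countEq v x = length (filter (_≟ v) x)

st-go : Word → Word → Word → Word
st-go x pre []         = []
st-go x pre (v ∷ rest) = (countLess v x + suc (countEq v pre)) ∷ st-go x (pre ++ [ v ]) rest

st : Word → Word
st x = st-go x [] x

InPrim : Word → Word → Set
InPrim p x = IsModAsc x × IsPrimitive x
  × (∀ y → IsCayley y → st y ≡ p → Avoids x y)

InΩ : Word → Set
InΩ q = IsPerm q
  × (length q ≡ 0 ⊎ nth q 0 ≡ 1)
  × (∀ i j → suc i < j → j < length q →
       ¬ (nth q i > nth q (suc i) × nth q (suc i) ≡ suc (nth q j)))

InΩof : Word → Word → Set
InΩof p q = InΩ q × Avoids q p

-- Standardization numbers the positions of x by value, ties broken from left to
-- right, so x contains some y with st y = p exactly when st x contains p.  In a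
-- modified ascent sequence the leftmost copies are the ascent tops; this makes
-- st x start with 1 and avoid the configuration excluded from Ω.  If moreover x
-- is primitive, its ascent tops are those of q = st x, so x is recovered from q
-- by x_i = #{ascent tops t of q with q_t ≤ q_i}.  Conversely, for q ∈ Ω this
-- formula yields a primitive modified ascent sequence standardizing to q: a tie
-- x_i = x_j with q_i < q_j forces i < j, by walking down from q_j through the
-- values q_j - 1, q_j - 2, ..., each of which must lie to the left because q
-- avoids the pattern of Ω.
module Submission where

open import Defs
open import Data.Empty using (⊥-elim)
open import Data.List using ([]; _∷_; length; filter; _++_; [_]; take; map)
open import Data.List.Properties using (filter-accept; filter-reject; ++-assoc; ++-identityʳ; take-all; length-map; length-filter)
open import Data.List.Membership.Propositional using (_∈_)
open import Data.List.Relation.Unary.Any using (here; there)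
open import Data.List.Relation.Unary.All as All using ()
open import Data.List.Relation.Unary.Unique.Propositional using (Unique; []; _∷_)
open import Data.List.Relation.Binary.Sublist.Propositional using (_⊆_; []; _∷_; _∷ʳ_)
open import Data.Nat
open import Data.Nat.Induction using (<-rec)
open import Data.Nat.Properties
open import Data.Product using (∃-syntax; _×_; _,_; proj₁; proj₂; map₁; map₂)
open import Data.Sum using (_⊎_; inj₁; inj₂) renaming (map to ⊎-map; map₂ to ⊎-map₂)
open import Data.Unit using (tt)
open import Function.Base using (_∘_)
open import Function.Bundles using (_⇔_; mk⇔; Equivalence)
open import Function.Properties.Equivalence using () renaming (sym to ⇔-sym; trans to ⇔-trans)
open import Function.Related.Propositional as Related using ()
open import Level using (0ℓ)
open import Relation.Binary.Definitions using (tri<; tri≈; tri>)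
open import Relation.Binary.PropositionalEquality hiding ([_])
open import Relation.Nullary using (¬_; ¬?; yes; no; map′; _×-dec_)
open import Relation.Unary using (Pred; Decidable)

open Equivalence using (to; from)

nth-∈ : ∀ x {i} → i < length x → nth x i ∈ x
nth-∈ (v ∷ x) {zero}  _   = here refl
nth-∈ (v ∷ x) {suc i} i<n = there (nth-∈ x (s<s⁻¹ i<n))

∈⇒nth : ∀ {v} x → v ∈ x → ∃[ i ] (i < length x × nth x i ≡ v)
∈⇒nth (u ∷ x) (here refl) = 0 , z<s , refl
∈⇒nth (u ∷ x) (there v∈x) with i , i<n , xᵢ≡v ← ∈⇒nth x v∈x = suc i , s<s i<n , xᵢ≡v

nth-map : ∀ (f : ℕ → ℕ) x {i} → i < length x → nth (map f x) i ≡ f (nth x i)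
nth-map f (v ∷ x) {zero}  _   = refl
nth-map f (v ∷ x) {suc i} i<n = nth-map f x (s<s⁻¹ i<n)

NthInjective : Word → Set
NthInjective x = ∀ {i j} → i < length x → j < length x → nth x i ≡ nth x j → i ≡ j

Unique⇒nth-injective : ∀ x → Unique x → NthInjective x
Unique⇒nth-injective (v ∷ x) (v∉x ∷ u) {zero}  {zero}  _   _   _ = refl
Unique⇒nth-injective (v ∷ x) (v∉x ∷ u) {zero}  {suc j} _   j<n e = ⊥-elim (All.lookup v∉x (nth-∈ x (s<s⁻¹ j<n)) e)
Unique⇒nth-injective (v ∷ x) (v∉x ∷ u) {suc i} {zero}  i<n _   e = ⊥-elim (All.lookup v∉x (nth-∈ x (s<s⁻¹ i<n)) (sym e))
Unique⇒nth-injective (v ∷ x) (v∉x ∷ u) {suc i} {suc j} i<n j<n e =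
  cong suc (Unique⇒nth-injective x u (s<s⁻¹ i<n) (s<s⁻¹ j<n) e)

nth-injective⇒Unique : ∀ x → NthInjective x → Unique x
nth-injective⇒Unique []      _   = []
nth-injective⇒Unique (v ∷ x) inj =
  All.tabulate v≢ ∷ nth-injective⇒Unique x (λ i<n j<n e → suc-injective (inj (s<s i<n) (s<s j<n) e))
  where
  v≢ : ∀ {u} → u ∈ x → v ≢ u
  v≢ u∈x v≡u with j , j<n , xⱼ≡u ← ∈⇒nth x u∈x = 0≢1+n (inj z<s (s<s j<n) (trans v≡u (sym xⱼ≡u)))

nth-extensional : ∀ (x y : Word) → length x ≡ length y → (∀ i → i < length x → nth x i ≡ nth y i) → x ≡ y
nth-extensional []      []      _   _  = refl
nth-extensional (u ∷ x) (v ∷ y) len eq =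
  cong₂ _∷_ (eq 0 z<s) (nth-extensional x y (suc-injective len) (λ i i<n → eq (suc i) (s<s i<n)))

module Cayley {x : Word} (c : IsCayley x) where

  maxValue : ℕ
  maxValue = proj₁ c

  positive : ∀ {i} → i < length x → 1 ≤ nth x i
  positive i<n = proj₁ (proj₁ (proj₂ (proj₂ c)) _ i<n)

  bounded : ∀ {i} → i < length x → nth x i ≤ maxValue
  bounded i<n = proj₂ (proj₁ (proj₂ (proj₂ c)) _ i<n)

  onto : ∀ {v} → 1 ≤ v → v ≤ maxValue → ∃[ i ] (i < length x × nth x i ≡ v)
  onto 1≤v v≤k = ∈⇒nth x (proj₂ (proj₂ (proj₂ c)) _ 1≤v v≤k)

  predecessor : ∀ {i} → i < length x → 1 < nth x i → ∃[ u ] (u < length x × nth x i ≡ suc (nth x u))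
  predecessor {i} i<n 1<xᵢ with nth x i | bounded i<n | 1<xᵢ
  ... | suc v | 1+v≤k | s≤s 1≤v =
    let u , u<n , xᵤ≡v = onto 1≤v (≤-trans (n≤1+n v) 1+v≤k) in u , u<n , cong suc (sym xᵤ≡v)

-- Strong induction on the value v = x_s: y_s ≥ v since v - 1 occurs in x at a
-- position t with y_t = v - 1 < y_s, and y_s ≤ v since the value v of y
-- occurs at a position u with x_u < x_s, whence y_u = x_u < v.
Cayley-≡ : ∀ {x y} → IsCayley x → IsCayley y → length x ≡ length y →
  (∀ {s t} → s < length x → t < length x → nth x s < nth x t ⇔ nth y s < nth y t) → x ≡ y
Cayley-≡ {x} {y} cx cy len order =
  nth-extensional x y len (λ i i<n → sym (<-rec ValuePreserved preserve (nth x i) i<n refl))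
  where
  module X = Cayley cx
  module Y = Cayley cy

  ValuePreserved : ℕ → Set
  ValuePreserved v = ∀ {s} → s < length x → nth x s ≡ v → nth y s ≡ v

  toY : ∀ {s} → s < length x → s < length y
  toY = subst (_ <_) len

  toX : ∀ {s} → s < length y → s < length x
  toX = subst (_ <_) (sym len)

  preserve : ∀ v → (∀ {w} → w < v → ValuePreserved w) → ValuePreserved v
  preserve v ih {s} s<n xₛ≡v = ≤-antisym (≮⇒≥ not-above) not-below
    where
    not-below : v ≤ nth y s
    not-below with m≤n⇒m<n∨m≡n (X.positive s<n)
    ... | inj₂ 1≡xₛ = subst (_≤ nth y s) (trans 1≡xₛ xₛ≡v) (Y.positive (toY s<n))
    ... | inj₁ 1<xₛ =
      let t , t<n , xₛ≡1+xₜ = X.predecessor s<n 1<xₛ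
          xₜ<xₛ = subst (nth x t <_) (sym xₛ≡1+xₜ) ≤-refl
          yₜ≡xₜ = ih (subst (nth x t <_) xₛ≡v xₜ<xₛ) t<n refl
      in  subst (_≤ nth y s) (trans (cong suc yₜ≡xₜ) (trans (sym xₛ≡1+xₜ) xₛ≡v)) (to (order t<n s<n) xₜ<xₛ)
    not-above : ¬ (v < nth y s)
    not-above v<yₛ
      with u , u<n , yᵤ≡v ← Y.onto (subst (1 ≤_) xₛ≡v (X.positive s<n)) (≤-trans (<⇒≤ v<yₛ) (Y.bounded (toY s<n))) =
      <-irrefl (trans (sym yᵤ≡xᵤ) yᵤ≡v) xᵤ<v
      where
      xᵤ<v : nth x u < v
      xᵤ<v = subst (nth x u <_) xₛ≡v (from (order (toX u<n) s<n) (subst (_< nth y s) (sym yᵤ≡v) v<yₛ))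
      yᵤ≡xᵤ : nth y u ≡ nth x u
      yᵤ≡xᵤ = ih xᵤ<v (toX u<n) refl

count : {P : Pred ℕ 0ℓ} → Decidable P → ℕ → ℕ
count P? zero = 0
count P? (suc n) with P? n
... | yes _ = suc (count P? n)
... | no  _ = count P? n

module _ {P : Pred ℕ 0ℓ} (P? : Decidable P) where

  count-≤ : ∀ n → count P? n ≤ n
  count-≤ zero = z≤n
  count-≤ (suc n) with P? n
  ... | yes _ = s≤s (count-≤ n)
  ... | no  _ = m≤n⇒m≤1+n (count-≤ n)

  count-none : ∀ n → (∀ {t} → t < n → ¬ P t) → count P? n ≡ 0
  count-none zero    _    = refl
  count-none (suc n) none with P? n
  ... | yes Pn = ⊥-elim (none ≤-refl Pn)
  ... | no  _  = count-none n (none ∘ m<n⇒m<1+n)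

  count-all : ∀ n → (∀ {t} → t < n → P t) → count P? n ≡ n
  count-all zero    _   = refl
  count-all (suc n) all with P? n
  ... | yes _  = cong suc (count-all n (all ∘ m<n⇒m<1+n))
  ... | no ¬Pn = ⊥-elim (¬Pn (all ≤-refl))

module _ {P Q : Pred ℕ 0ℓ} (P? : Decidable P) (Q? : Decidable Q) where

  count-mono : ∀ n → (∀ {t} → t < n → P t → Q t) → count P? n ≤ count Q? n
  count-mono zero    _   = z≤n
  count-mono (suc n) P⇒Q with P? n | Q? n
  ... | yes _  | yes _  = s≤s (count-mono n (P⇒Q ∘ m<n⇒m<1+n))
  ... | yes Pn | no ¬Qn = ⊥-elim (¬Qn (P⇒Q ≤-refl Pn))
  ... | no _   | yes _  = m≤n⇒m≤1+n (count-mono n (P⇒Q ∘ m<n⇒m<1+n))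
  ... | no _   | no _   = count-mono n (P⇒Q ∘ m<n⇒m<1+n)

module _ {P Q : Pred ℕ 0ℓ} (P? : Decidable P) (Q? : Decidable Q) where

  count-mono-< : ∀ n → (∀ {t} → t < n → P t → Q t) →
    ∀ {t} → t < n → Q t → ¬ P t → count P? n < count Q? n
  count-mono-< (suc n) P⇒Q {t} t<1+n Qt ¬Pt with P? n | Q? n | m<1+n⇒m<n∨m≡n t<1+n
  ... | yes _  | yes _  | inj₁ t<n  = s≤s (count-mono-< n (P⇒Q ∘ m<n⇒m<1+n) t<n Qt ¬Pt)
  ... | yes Pn | _      | inj₂ refl = ⊥-elim (¬Pt Pn)
  ... | yes Pn | no ¬Qn | inj₁ _    = ⊥-elim (¬Qn (P⇒Q ≤-refl Pn))
  ... | no _   | yes _  | _         = s≤s (count-mono P? Q? n (P⇒Q ∘ m<n⇒m<1+n))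
  ... | no _   | no ¬Qn | inj₂ refl = ⊥-elim (¬Qn Qt)
  ... | no _   | no _   | inj₁ t<n  = count-mono-< n (P⇒Q ∘ m<n⇒m<1+n) t<n Qt ¬Pt

  count-<⇒∃ : ∀ n → count P? n < count Q? n → ∃[ t ] (t < n × Q t × ¬ P t)
  count-<⇒∃ (suc n) lt with P? n | Q? n
  ... | no ¬Pn | yes Qn = n , ≤-refl , Qn , ¬Pn
  ... | yes _  | yes _  = map₂ (map₁ m<n⇒m<1+n) (count-<⇒∃ n (s<s⁻¹ lt))
  ... | yes _  | no _   = map₂ (map₁ m<n⇒m<1+n) (count-<⇒∃ n (<-trans (n<1+n _) lt))
  ... | no _   | no _   = map₂ (map₁ m<n⇒m<1+n) (count-<⇒∃ n lt)

  count-≤-suc : ∀ n → (∀ {t} → t < n → P t → Q t) →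
    (∀ {t u} → t < n → u < n → Q t × ¬ P t → Q u × ¬ P u → t ≡ u) →
    count Q? n ≤ suc (count P? n)
  count-≤-suc zero    _   _    = z≤n
  count-≤-suc (suc n) P⇒Q once with P? n | Q? n
  ... | yes _  | yes _  = s≤s (count-≤-suc n (P⇒Q ∘ m<n⇒m<1+n) (λ t<n u<n → once (m<n⇒m<1+n t<n) (m<n⇒m<1+n u<n)))
  ... | yes Pn | no ¬Qn = ⊥-elim (¬Qn (P⇒Q ≤-refl Pn))
  ... | no _   | no _   = count-≤-suc n (P⇒Q ∘ m<n⇒m<1+n) (λ t<n u<n → once (m<n⇒m<1+n t<n) (m<n⇒m<1+n u<n))
  ... | no ¬Pn | yes Qn = s≤s (count-mono Q? P? n Q⇒P)
    where
    Q⇒P : ∀ {t} → t < n → Q t → P t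
    Q⇒P {t} t<n Qt with P? t
    ... | yes Pt = Pt
    ... | no ¬Pt = ⊥-elim (<-irrefl (once (m<n⇒m<1+n t<n) ≤-refl (Qt , ¬Pt) (Qn , ¬Pn)) t<n)

  count-cong : ∀ n → (∀ {t} → t < n → P t ⇔ Q t) → count P? n ≡ count Q? n
  count-cong n P⇔Q = ≤-antisym (count-mono P? Q? n (to ∘ P⇔Q)) (count-mono Q? P? n (from ∘ P⇔Q))

discrete-ivt : ∀ (g : ℕ → ℕ) {v} b → g 0 < v → v ≤ g b → ∃[ r ] (g r < v × v ≤ g (suc r))
discrete-ivt g zero    g0<v v≤g0 = ⊥-elim (<⇒≱ g0<v v≤g0)
discrete-ivt g {v} (suc b) g0<v v≤gb with v ≤? g b
... | yes v≤gb′ = discrete-ivt g b g0<v v≤gb′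
... | no  v≰gb′ = b , ≰⇒> v≰gb′ , v≤gb

-- c r counts the i < n with f i ≤ r.  Injectivity makes c grow by at most one
-- per step, so c 0 = 0 and c n = n force c r = r, and f takes the value v
-- exactly where c steps from v - 1 to v.
injective⇒onto : ∀ n (f : ℕ → ℕ) → (∀ {i} → i < n → 1 ≤ f i × f i ≤ n) →
  (∀ {i j} → i < n → j < n → f i ≡ f j → i ≡ j) →
  ∀ {v} → 1 ≤ v → v ≤ n → ∃[ i ] (i < n × f i ≡ v)
injective⇒onto n f bounds inj {suc v} _ v<n =
  let i , i<n , fᵢ≤v , fᵢ≰v-1 = count-<⇒∃ (below v) (below (suc v)) n (<-≤-trans (s≤s (c≤ v)) (≤c (suc v) v<n))
  in  i , i<n , ≤-antisym fᵢ≤v (≰⇒> fᵢ≰v-1)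
  where
  below : ∀ r → Decidable (λ i → f i ≤ r)
  below r i = f i ≤? r
  c : ℕ → ℕ
  c r = count (below r) n

  c-suc : ∀ r → c (suc r) ≤ suc (c r)
  c-suc r = count-≤-suc (below r) (below (suc r)) n (λ _ → m≤n⇒m≤1+n)
    (λ t<n u<n (fₜ≤ , fₜ≰) (fᵤ≤ , fᵤ≰) →
      inj t<n u<n (trans (≤-antisym fₜ≤ (≰⇒> fₜ≰)) (sym (≤-antisym fᵤ≤ (≰⇒> fᵤ≰)))))

  c≤ : ∀ r → c r ≤ r
  c≤ zero    = ≤-reflexive (count-none (below 0) n (λ i<n fᵢ≤0 → <⇒≱ (proj₁ (bounds i<n)) fᵢ≤0))
  c≤ (suc r) = ≤-trans (c-suc r) (s≤s (c≤ r))

  c-+ : ∀ r k → c (r + k) ≤ c r + k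
  c-+ r zero    = ≤-reflexive (trans (cong c (+-identityʳ r)) (sym (+-identityʳ (c r))))
  c-+ r (suc k) = begin
    c (r + suc k)   ≡⟨ cong c (+-suc r k) ⟩
    c (suc (r + k)) ≤⟨ c-suc (r + k) ⟩
    suc (c (r + k)) ≤⟨ s≤s (c-+ r k) ⟩
    suc (c r + k)   ≡⟨ +-suc (c r) k ⟨
    c r + suc k     ∎
    where open ≤-Reasoning

  ≤c : ∀ r → r ≤ n → r ≤ c r
  ≤c r r≤n = +-cancelʳ-≤ (n ∸ r) r (c r) (begin
    r + (n ∸ r)   ≡⟨ m+[n∸m]≡n r≤n ⟩
    n             ≡⟨ count-all (below n) n (proj₂ ∘ bounds) ⟨
    c n           ≡⟨ cong c (m+[n∸m]≡n r≤n) ⟨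
    c (r + (n ∸ r)) ≤⟨ c-+ r (n ∸ r) ⟩
    c r + (n ∸ r) ∎)
    where open ≤-Reasoning

filter-disjoint-length : ∀ {P Q R : Pred ℕ 0ℓ} (P? : Decidable P) (Q? : Decidable Q) (R? : Decidable R) →
  (∀ {y} → P y → ¬ Q y) → (∀ {y} → P y ⊎ Q y → R y) →
  ∀ xs → length (filter P? xs) + length (filter Q? xs) ≤ length (filter R? xs)
filter-disjoint-length P? Q? R? disjoint cover []       = z≤n
filter-disjoint-length P? Q? R? disjoint cover (y ∷ xs) with P? y | Q? y | R? y
... | yes Py | yes Qy | _      = ⊥-elim (disjoint Py Qy)
... | yes _  | no _   | yes _  = s≤s (filter-disjoint-length P? Q? R? disjoint cover xs)
... | yes Py | no _   | no ¬Ry = ⊥-elim (¬Ry (cover (inj₁ Py)))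
... | no _   | yes _  | yes _  = subst (_≤ suc (length (filter R? xs))) (sym (+-suc (length (filter P? xs)) _))
  (s≤s (filter-disjoint-length P? Q? R? disjoint cover xs))
... | no _   | yes Qy | no ¬Ry = ⊥-elim (¬Ry (cover (inj₂ Qy)))
... | no _   | no _   | yes _  = m≤n⇒m≤1+n (filter-disjoint-length P? Q? R? disjoint cover xs)
... | no _   | no _   | no _   = filter-disjoint-length P? Q? R? disjoint cover xs

countLess+countEq≤countLess : ∀ {a b} → a < b → ∀ xs → countLess a xs + countEq a xs ≤ countLess b xs
countLess+countEq≤countLess {a} {b} a<b =
  filter-disjoint-length (_<? a) (_≟ a) (_<? b) (λ y<a y≡a → <-irrefl y≡a y<a)
    λ { (inj₁ y<a) → <-trans y<a a<b ; (inj₂ refl) → a<b }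

countLess+countEq≤length : ∀ a xs → countLess a xs + countEq a xs ≤ length xs
countLess+countEq≤length a xs = ≤-trans
  (filter-disjoint-length (_<? a) (_≟ a) (λ _ → yes tt) (λ y<a y≡a → <-irrefl y≡a y<a) (λ _ → tt) xs)
  (length-filter (λ _ → yes tt) xs)

countEq-take-< : ∀ x {i j} → i < j → j ≤ length x → countEq (nth x i) (take i x) < countEq (nth x i) (take j x)
countEq-take-< (v ∷ x) {zero}  {suc j} _   _   rewrite filter-accept (_≟ v) {xs = take j x} refl = z<s
countEq-take-< (v ∷ x) {suc i} {suc j} i<j j≤n with v ≟ nth x i
... | yes v≡xᵢ rewrite filter-accept (_≟ nth x i) {xs = take i x} v≡xᵢ | filter-accept (_≟ nth x i) {xs = take j x} v≡xᵢ =
  s<s (countEq-take-< x (s<s⁻¹ i<j) (s≤s⁻¹ j≤n))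
... | no v≢xᵢ rewrite filter-reject (_≟ nth x i) {xs = take i x} v≢xᵢ | filter-reject (_≟ nth x i) {xs = take j x} v≢xᵢ =
  countEq-take-< x (s<s⁻¹ i<j) (s≤s⁻¹ j≤n)

st-go-length : ∀ x pre rest → length (st-go x pre rest) ≡ length rest
st-go-length x pre []         = refl
st-go-length x pre (v ∷ rest) = cong suc (st-go-length x (pre ++ [ v ]) rest)

length-st : ∀ x → length (st x) ≡ length x
length-st x = st-go-length x [] x

st-go-nth : ∀ x pre rest {i} → i < length rest →
  nth (st-go x pre rest) i ≡ countLess (nth rest i) x + suc (countEq (nth rest i) (pre ++ take i rest))
st-go-nth x pre (v ∷ rest) {zero}  _   = cong (λ l → countLess v x + suc (countEq v l)) (sym (++-identityʳ pre))
st-go-nth x pre (v ∷ rest) {suc i} i<n = trans (st-go-nth x (pre ++ [ v ]) rest (s<s⁻¹ i<n))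
  (cong (λ l → countLess (nth rest i) x + suc (countEq (nth rest i) l)) (++-assoc pre [ v ] (take i rest)))

nth-st : ∀ x {i} → i < length x →
  nth (st x) i ≡ countLess (nth x i) x + suc (countEq (nth x i) (take i x))
nth-st x = st-go-nth x [] x

-- The order in which standardization numbers the positions of x.
_≺⟨_⟩_ : ℕ → Word → ℕ → Set
i ≺⟨ x ⟩ j = nth x i < nth x j ⊎ (nth x i ≡ nth x j × i < j)

≺-connex : ∀ x {i j} → i ≢ j → i ≺⟨ x ⟩ j ⊎ j ≺⟨ x ⟩ i
≺-connex x {i} {j} i≢j with <-cmp (nth x i) (nth x j) | <-cmp i j
... | tri< xᵢ<xⱼ _ _ | _              = inj₁ (inj₁ xᵢ<xⱼ)
... | tri> _ _ xⱼ<xᵢ | _              = inj₂ (inj₁ xⱼ<xᵢ)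
... | tri≈ _ xᵢ≡xⱼ _ | tri< i<j _ _   = inj₁ (inj₂ (xᵢ≡xⱼ , i<j))
... | tri≈ _ _ _     | tri≈ _ i≡j _   = ⊥-elim (i≢j i≡j)
... | tri≈ _ xᵢ≡xⱼ _ | tri> _ _ j<i   = inj₂ (inj₂ (sym xᵢ≡xⱼ , j<i))

nth-st≤countLess+countEq : ∀ x {i} → i < length x → nth (st x) i ≤ countLess (nth x i) x + countEq (nth x i) x
nth-st≤countLess+countEq x {i} i<n = begin
  nth (st x) i                                  ≡⟨ nth-st x i<n ⟩
  countLess a x + suc (countEq a (take i x))    ≤⟨ +-monoʳ-≤ (countLess a x) (countEq-take-< x i<n ≤-refl) ⟩
  countLess a x + countEq a (take (length x) x) ≡⟨ cong (λ l → countLess a x + countEq a l) (take-all (length x) x ≤-refl) ⟩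
  countLess a x + countEq a x                   ∎
  where
  open ≤-Reasoning
  a = nth x i

st-<-value : ∀ x {i j} → i < length x → j < length x → nth x i < nth x j → nth (st x) i < nth (st x) j
st-<-value x {i} {j} i<n j<n xᵢ<xⱼ = begin-strict
  nth (st x) i                                          ≤⟨ nth-st≤countLess+countEq x i<n ⟩
  countLess (nth x i) x + countEq (nth x i) x           ≤⟨ countLess+countEq≤countLess xᵢ<xⱼ x ⟩
  countLess (nth x j) x                                 <⟨ m<m+n (countLess (nth x j) x) z<s ⟩
  countLess (nth x j) x + suc (countEq (nth x j) (take j x)) ≡⟨ nth-st x j<n ⟨
  nth (st x) j                                          ∎
  where open ≤-Reasoning

st-<-tie : ∀ x {i j} → i < j → j < length x → nth x i ≡ nth x j → nth (st x) i < nth (st x) j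
st-<-tie x {i} {j} i<j j<n xᵢ≡xⱼ = begin-strict
  nth (st x) i                                          ≡⟨ nth-st x (<-trans i<j j<n) ⟩
  countLess a x + suc (countEq a (take i x))            <⟨ +-monoʳ-< (countLess a x) (s≤s (countEq-take-< x i<j (<⇒≤ j<n))) ⟩
  countLess a x + suc (countEq a (take j x))            ≡⟨ cong (λ c → countLess c x + suc (countEq c (take j x))) xᵢ≡xⱼ ⟩
  countLess b x + suc (countEq b (take j x))            ≡⟨ nth-st x j<n ⟨
  nth (st x) j                                          ∎
  where
  open ≤-Reasoning
  a = nth x i
  b = nth x j

≺⇒st-< : ∀ x {i j} → i < length x → j < length x → i ≺⟨ x ⟩ j → nth (st x) i < nth (st x) j
≺⇒st-< x i<n j<n (inj₁ xᵢ<xⱼ)         = st-<-value x i<n j<n xᵢ<xⱼ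
≺⇒st-< x i<n j<n (inj₂ (xᵢ≡xⱼ , i<j)) = st-<-tie x i<j j<n xᵢ≡xⱼ

st-<⇔≺ : ∀ x {i j} → i < length x → j < length x → nth (st x) i < nth (st x) j ⇔ i ≺⟨ x ⟩ j
st-<⇔≺ x {i} {j} i<n j<n = mk⇔ st-<⇒≺ (≺⇒st-< x i<n j<n)
  where
  st-<⇒≺ : nth (st x) i < nth (st x) j → i ≺⟨ x ⟩ j
  st-<⇒≺ stᵢ<stⱼ with i ≟ j
  ... | yes refl = ⊥-elim (<-irrefl refl stᵢ<stⱼ)
  ... | no i≢j with ≺-connex x i≢j
  ...   | inj₁ i≺j = i≺j
  ...   | inj₂ j≺i = ⊥-elim (<-asym stᵢ<stⱼ (≺⇒st-< x j<n i<n j≺i))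

<-length-st : ∀ x {i} → i < length (st x) → i < length x
<-length-st x = subst (_ <_) (length-st x)

st-injective : ∀ x → NthInjective (st x)
st-injective x {i} {j} i<n j<n stᵢ≡stⱼ with i ≟ j
... | yes i≡j = i≡j
... | no  i≢j with ≺-connex x i≢j
...   | inj₁ i≺j = ⊥-elim (<-irrefl stᵢ≡stⱼ (≺⇒st-< x (<-length-st x i<n) (<-length-st x j<n) i≺j))
...   | inj₂ j≺i = ⊥-elim (<-irrefl (sym stᵢ≡stⱼ) (≺⇒st-< x (<-length-st x j<n) (<-length-st x i<n) j≺i))

st-isPerm : ∀ x → IsPerm (st x)
st-isPerm x = (length x , ≤-reflexive (sym (length-st x)) , bounds , onto) , nth-injective⇒Unique (st x) (st-injective x)
  where
  bounds′ : ∀ {i} → i < length x → 1 ≤ nth (st x) i × nth (st x) i ≤ length x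
  bounds′ {i} i<n =
      subst (1 ≤_) (sym (nth-st x i<n)) (≤-trans (s≤s z≤n) (m≤n+m _ (countLess (nth x i) x)))
    , ≤-trans (nth-st≤countLess+countEq x i<n) (countLess+countEq≤length (nth x i) x)
  bounds : ∀ i → i < length (st x) → 1 ≤ nth (st x) i × nth (st x) i ≤ length x
  bounds i i<n = bounds′ (<-length-st x i<n)
  onto : ∀ v → 1 ≤ v → v ≤ length x → v ∈ st x
  onto v 1≤v v≤n =
    let i , i<n , stᵢ≡v = injective⇒onto (length x) (nth (st x)) bounds′
                            (λ i<n j<n → st-injective x (toSt i<n) (toSt j<n)) 1≤v v≤n
    in  subst (_∈ st x) stᵢ≡v (nth-∈ (st x) (toSt i<n))
    where
    toSt : ∀ {i} → i < length x → i < length (st x)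
    toSt = subst (_ <_) (sym (length-st x))

⊆-index : ∀ {z u : Word} → z ⊆ u → ℕ → ℕ
⊆-index []       s       = 0
⊆-index (_ ∷ʳ σ) s       = suc (⊆-index σ s)
⊆-index (_ ∷ σ)  zero    = 0
⊆-index (_ ∷ σ)  (suc s) = suc (⊆-index σ s)

⊆-index-< : ∀ {z u : Word} (σ : z ⊆ u) {s} → s < length z → ⊆-index σ s < length u
⊆-index-< (_ ∷ʳ σ) s<n             = s<s (⊆-index-< σ s<n)
⊆-index-< (_ ∷ σ)  {zero}  _       = z<s
⊆-index-< (_ ∷ σ)  {suc s} (s<s s<n) = s<s (⊆-index-< σ s<n)

⊆-index-mono : ∀ {z u : Word} (σ : z ⊆ u) {s t} → s < t → t < length z → ⊆-index σ s < ⊆-index σ t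
⊆-index-mono (_ ∷ʳ σ) s<t t<n                           = s<s (⊆-index-mono σ s<t t<n)
⊆-index-mono (_ ∷ σ)  {zero}  {suc t} _         _         = z<s
⊆-index-mono (_ ∷ σ)  {suc s} {suc t} (s<s s<t) (s<s t<n) = s<s (⊆-index-mono σ s<t t<n)

⊆-index-<⇔ : ∀ {z u : Word} (σ : z ⊆ u) {s t} → s < length z → t < length z → ⊆-index σ s < ⊆-index σ t ⇔ s < t
⊆-index-<⇔ σ {s} {t} s<n t<n = mk⇔ reflect (λ s<t → ⊆-index-mono σ s<t t<n)
  where
  reflect : ⊆-index σ s < ⊆-index σ t → s < t
  reflect lt with <-cmp s t
  ... | tri< s<t _ _ = s<t
  ... | tri≈ _ refl _ = ⊥-elim (<-irrefl refl lt)
  ... | tri> _ _ t<s = ⊥-elim (<-asym lt (⊆-index-mono σ t<s s<n))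

nth-⊆-index : ∀ {z u : Word} (σ : z ⊆ u) {s} → s < length z → nth z s ≡ nth u (⊆-index σ s)
nth-⊆-index (_ ∷ʳ σ) s<n               = nth-⊆-index σ s<n
nth-⊆-index (u≡z ∷ σ) {zero}  _        = u≡z
nth-⊆-index (_ ∷ σ)  {suc s} (s<s s<n) = nth-⊆-index σ s<n

-- The entries of x at the positions where σ embeds z in u (x and u have equal length).
select : ∀ {z u : Word} → z ⊆ u → Word → Word
select []       _       = []
select (_ ∷ʳ σ) []      = []
select (_ ∷ʳ σ) (_ ∷ x) = select σ x
select (_ ∷ σ)  []      = []
select (_ ∷ σ)  (v ∷ x) = v ∷ select σ x

select-⊆ : ∀ {z u : Word} (σ : z ⊆ u) → ∀ x → length u ≡ length x → select σ x ⊆ x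
select-⊆ []       []      _   = []
select-⊆ (_ ∷ʳ σ) (v ∷ x) len = v ∷ʳ select-⊆ σ x (suc-injective len)
select-⊆ (_ ∷ σ)  (v ∷ x) len = refl ∷ select-⊆ σ x (suc-injective len)

length-select : ∀ {z u : Word} (σ : z ⊆ u) → ∀ x → length u ≡ length x → length (select σ x) ≡ length z
length-select []       []      _   = refl
length-select (_ ∷ʳ σ) (v ∷ x) len = length-select σ x (suc-injective len)
length-select (_ ∷ σ)  (v ∷ x) len = cong suc (length-select σ x (suc-injective len))

nth-select : ∀ {z u : Word} (σ : z ⊆ u) → ∀ x → length u ≡ length x →
  ∀ {s} → s < length z → nth (select σ x) s ≡ nth x (⊆-index σ s)
nth-select (_ ∷ʳ σ) (v ∷ x) len s<n               = nth-select σ x (suc-injective len) s<n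
nth-select (_ ∷ σ)  (v ∷ x) len {zero}  _         = refl
nth-select (_ ∷ σ)  (v ∷ x) len {suc s} (s<s s<n) = nth-select σ x (suc-injective len) s<n

⊆-index-injective : ∀ {z u : Word} (σ : z ⊆ u) {s t} → s < length z → t < length z →
  ⊆-index σ s ≡ ⊆-index σ t → s ≡ t
⊆-index-injective σ {s} {t} s<n t<n eq with <-cmp s t
... | tri< s<t _ _ = ⊥-elim (<-irrefl eq (⊆-index-mono σ s<t t<n))
... | tri≈ _ s≡t _ = s≡t
... | tri> _ _ t<s = ⊥-elim (<-irrefl (sym eq) (⊆-index-mono σ t<s s<n))

≺-reindex : ∀ {z u : Word} (σ : z ⊆ u) w x → (∀ {s} → s < length z → nth w s ≡ nth x (⊆-index σ s)) →
  ∀ {s t} → s < length z → t < length z → s ≺⟨ w ⟩ t ⇔ ⊆-index σ s ≺⟨ x ⟩ ⊆-index σ t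
≺-reindex σ w x eq {s} {t} s<n t<n rewrite eq s<n | eq t<n =
  mk⇔ (⊎-map₂ (map₂ (from (⊆-index-<⇔ σ s<n t<n)))) (⊎-map₂ (map₂ (to (⊆-index-<⇔ σ s<n t<n))))

≺-SamePattern : ∀ {z y} → SamePattern z y → ∀ {s t} → s < length y → t < length y → s ≺⟨ z ⟩ t ⇔ s ≺⟨ y ⟩ t
≺-SamePattern (_ , same) {s} {t} s<n t<n =
  mk⇔ (⊎-map (to <⇔) (map₁ (to ≡⇔))) (⊎-map (from <⇔) (map₁ (from ≡⇔)))
  where
  <⇔ = proj₁ (same s t s<n t<n)
  ≡⇔ = proj₂ (same s t s<n t<n)

st-Contains : ∀ x y → Contains x y → Contains (st x) (st y)
st-Contains x y (z , σ , z≈y@(lz≡ly , _)) = w , select-⊆ σ (st x) (sym (length-st x)) , lw≡lsty , same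
  where
  open Related.EquationalReasoning
  w = select σ (st x)
  lw≡lsty : length w ≡ length (st y)
  lw≡lsty = trans (length-select σ (st x) (sym (length-st x))) (trans lz≡ly (sym (length-st y)))
  same : ∀ s t → s < length (st y) → t < length (st y) →
    (nth w s < nth w t ⇔ nth (st y) s < nth (st y) t) × (nth w s ≡ nth w t ⇔ nth (st y) s ≡ nth (st y) t)
  same s t s<n t<n = lt , eq
    where
    s<y = <-length-st y s<n
    t<y = <-length-st y t<n
    s<z = subst (_ <_) (sym lz≡ly) s<y
    t<z = subst (_ <_) (sym lz≡ly) t<y
    e = ⊆-index σ
    wₛ≡ = nth-select σ (st x) (sym (length-st x)) s<z
    wₜ≡ = nth-select σ (st x) (sym (length-st x)) t<z
    lt : nth w s < nth w t ⇔ nth (st y) s < nth (st y) t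
    lt = begin
      nth w s < nth w t                  ≡⟨ cong₂ _<_ wₛ≡ wₜ≡ ⟩
      nth (st x) (e s) < nth (st x) (e t) ∼⟨ st-<⇔≺ x (⊆-index-< σ s<z) (⊆-index-< σ t<z) ⟩
      e s ≺⟨ x ⟩ e t                     ∼⟨ ⇔-sym (≺-reindex σ z x (nth-⊆-index σ) s<z t<z) ⟩
      s ≺⟨ z ⟩ t                         ∼⟨ ≺-SamePattern {z} {y} z≈y s<y t<y ⟩
      s ≺⟨ y ⟩ t                         ∼⟨ ⇔-sym (st-<⇔≺ y s<y t<y) ⟩
      nth (st y) s < nth (st y) t        ∎
    eq : nth w s ≡ nth w t ⇔ nth (st y) s ≡ nth (st y) t
    eq = mk⇔
      (λ wₛ≡wₜ → cong (nth (st y)) (⊆-index-injective σ s<z t<z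
        (st-injective x (toSt (⊆-index-< σ s<z)) (toSt (⊆-index-< σ t<z)) (trans (sym wₛ≡) (trans wₛ≡wₜ wₜ≡)))))
      (λ stₛ≡stₜ → subst (λ r → nth w s ≡ nth w r) (st-injective y s<n t<n stₛ≡stₜ) refl)
      where
      toSt : ∀ {i} → i < length x → i < length (st x)
      toSt = subst (_ <_) (sym (length-st x))

-- The entries of w renumbered by their rank among the values at the
-- positions in D; for D the leftmost copies this is the Cayley permutation
-- order isomorphic to w.
module Ranks {D : Pred ℕ 0ℓ} (D? : Decidable D) (w : Word) where

  n : ℕ
  n = length w

  atMost : ∀ r → Decidable (λ t → D t × nth w t ≤ r)
  atMost r t = D? t ×-dec nth w t ≤? r

  rank : ℕ → ℕ
  rank r = count (atMost r) n

  ranks : Word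
  ranks = map rank w

  length-ranks : length ranks ≡ n
  length-ranks = length-map rank w

  nth-ranks : ∀ {s} → s < n → nth ranks s ≡ rank (nth w s)
  nth-ranks = nth-map rank w

  rank-mono : ∀ {r r′} → r ≤ r′ → rank r ≤ rank r′
  rank-mono {r} {r′} r≤r′ = count-mono (atMost r) (atMost r′) n (λ _ (Dt , wₜ≤r) → Dt , ≤-trans wₜ≤r r≤r′)

  rank-mono-< : ∀ {r r′ t} → t < n → D t → r < nth w t → nth w t ≤ r′ → rank r < rank r′
  rank-mono-< {r} {r′} t<n Dt r<wₜ wₜ≤r′ with r ≤? r′
  ... | yes r≤r′ = count-mono-< (atMost r) (atMost r′) n (λ _ (Du , wᵤ≤r) → Du , ≤-trans wᵤ≤r r≤r′)
                     t<n (Dt , wₜ≤r′) (<⇒≱ r<wₜ ∘ proj₂)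
  ... | no  r≰r′ = ⊥-elim (r≰r′ (≤-trans (<⇒≤ r<wₜ) wₜ≤r′))

  rank-skip : ∀ {r} → (∀ {t} → t < n → D t → nth w t ≢ suc r) → rank (suc r) ≡ rank r
  rank-skip {r} skip = count-cong (atMost (suc r)) (atMost r) n λ t<n →
    mk⇔ (λ (Dt , wₜ≤1+r) → Dt , s≤s⁻¹ (≤∧≢⇒< wₜ≤1+r (skip t<n Dt)))
        (λ (Dt , wₜ≤r) → Dt , m≤n⇒m≤1+n wₜ≤r)

  Dominated : Set
  Dominated = ∀ {s} → s < n → ∃[ t ] (t < n × D t × nth w t ≤ nth w s)

  DistinctValues : Set
  DistinctValues = ∀ {t u} → t < n → u < n → D t → D u → nth w t ≡ nth w u → t ≡ u

  Separated : Set
  Separated = ∀ {s t} → s < n → t < n → nth w s < nth w t →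
    ∃[ u ] (u < n × D u × nth w s < nth w u × nth w u ≤ nth w t)

  module _ (dominated : Dominated) (distinct : DistinctValues)
           (positive : ∀ {s} → s < n → 1 ≤ nth w s) {B} (bounded : ∀ {s} → s < n → nth w s ≤ B) where

    rank-0 : rank 0 ≡ 0
    rank-0 = count-none (atMost 0) n (λ t<n (_ , wₜ≤0) → <⇒≱ (positive t<n) wₜ≤0)

    rank-suc : ∀ r → rank (suc r) ≤ suc (rank r)
    rank-suc r = count-≤-suc (atMost r) (atMost (suc r)) n (λ _ (Dt , wₜ≤r) → Dt , m≤n⇒m≤1+n wₜ≤r)
      λ t<n u<n ((Dt , wₜ≤1+r) , wₜ≰r) ((Du , wᵤ≤1+r) , wᵤ≰r) → distinct t<n u<n Dt Du
        (trans (≤-antisym wₜ≤1+r (≰⇒> (wₜ≰r ∘ (Dt ,_)))) (sym (≤-antisym wᵤ≤1+r (≰⇒> (wᵤ≰r ∘ (Du ,_))))))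

    rank-B : rank B ≡ count D? n
    rank-B = count-cong (atMost B) D? n (λ t<n → mk⇔ proj₁ (_, bounded t<n))

    ranks-isCayley : IsCayley ranks
    ranks-isCayley = count D? n , subst (count D? n ≤_) (sym length-ranks) (count-≤ D? n) , bounds , onto
      where
      bounds : ∀ i → i < length ranks → 1 ≤ nth ranks i × nth ranks i ≤ count D? n
      bounds i i<n′ rewrite nth-ranks (subst (i <_) length-ranks i<n′) =
        let i<n = subst (i <_) length-ranks i<n′
            t , t<n , Dt , wₜ≤wᵢ = dominated i<n
        in  subst (_< rank (nth w i)) rank-0 (rank-mono-< t<n Dt (positive t<n) wₜ≤wᵢ)
          , count-mono (atMost (nth w i)) D? n (λ _ → proj₁)
      onto : ∀ v → 1 ≤ v → v ≤ count D? n → v ∈ ranks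
      onto v 1≤v v≤max =
        let r , rankᵣ<v , v≤rank₁₊ᵣ = discrete-ivt rank B (subst (_< v) (sym rank-0) 1≤v) (subst (v ≤_) (sym rank-B) v≤max)
            t , t<n , (Dt , wₜ≤1+r) , wₜ≰r = count-<⇒∃ (atMost r) (atMost (suc r)) n (<-≤-trans rankᵣ<v v≤rank₁₊ᵣ)
            wₜ≡1+r = ≤-antisym wₜ≤1+r (≰⇒> (wₜ≰r ∘ (Dt ,_)))
            rank₁₊ᵣ≡v = ≤-antisym (≤-trans (rank-suc r) rankᵣ<v) v≤rank₁₊ᵣ
        in  subst (_∈ ranks) (trans (nth-ranks t<n) (trans (cong rank wₜ≡1+r) rank₁₊ᵣ≡v))
              (nth-∈ ranks (subst (t <_) (sym length-ranks) t<n))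

  ranks-≤ : ∀ {s t} → s < n → t < n → nth w s ≤ nth w t → nth ranks s ≤ nth ranks t
  ranks-≤ s<n t<n wₛ≤wₜ = subst₂ _≤_ (sym (nth-ranks s<n)) (sym (nth-ranks t<n)) (rank-mono wₛ≤wₜ)

  module _ (separated : Separated) where

    ranks-< : ∀ {s t} → s < n → t < n → nth w s < nth w t → nth ranks s < nth ranks t
    ranks-< s<n t<n wₛ<wₜ =
      let u , u<n , Du , wₛ<wᵤ , wᵤ≤wₜ = separated s<n t<n wₛ<wₜ
      in  subst₂ _<_ (sym (nth-ranks s<n)) (sym (nth-ranks t<n)) (rank-mono-< u<n Du wₛ<wᵤ wᵤ≤wₜ)

    ranks-SamePattern : SamePattern w ranks
    ranks-SamePattern = sym length-ranks , λ s t s<n′ t<n′ →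
      let s<n = subst (s <_) length-ranks s<n′
          t<n = subst (t <_) length-ranks t<n′
      in  mk⇔ (ranks-< s<n t<n) (λ rₛ<rₜ → ≰⇒> (<⇒≱ rₛ<rₜ ∘ ranks-≤ t<n s<n))
        , mk⇔ (λ wₛ≡wₜ → ≤-antisym (ranks-≤ s<n t<n (≤-reflexive wₛ≡wₜ))
                                   (ranks-≤ t<n s<n (≤-reflexive (sym wₛ≡wₜ))))
              (λ rₛ≡rₜ → ≤-antisym (≮⇒≥ (<-irrefl (sym rₛ≡rₜ) ∘ ranks-< t<n s<n))
                                   (≮⇒≥ (<-irrefl rₛ≡rₜ ∘ ranks-< s<n t<n)))

leftmostCopy? : ∀ w → Decidable (LeftmostCopyAt w)
leftmostCopy? w i = map′ (λ all j j<i → all j<i) (λ lc {j} → lc j) (allUpTo? (λ j → ¬? (nth w j ≟ nth w i)) i)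

firstCopy : ∀ w {s} → s < length w → ∃[ t ] (t ≤ s × nth w t ≡ nth w s × LeftmostCopyAt w t)
firstCopy (v ∷ w) {s} s<n with v ≟ nth (v ∷ w) s
... | yes v≡wₛ = 0 , z≤n , v≡wₛ , λ _ ()
firstCopy (v ∷ w) {zero}  _         | no v≢wₛ = ⊥-elim (v≢wₛ refl)
firstCopy (v ∷ w) {suc s} (s<s s<n) | no v≢wₛ =
  let t , t≤s , wₜ≡wₛ , leftmost = firstCopy w s<n
  in  suc t , s≤s t≤s , wₜ≡wₛ , λ where
        zero    _         v≡wₜ → v≢wₛ (trans v≡wₜ wₜ≡wₛ)
        (suc j) (s<s j<t)      → leftmost j j<t

leftmostCopy-unique : ∀ w {t u} → LeftmostCopyAt w t → LeftmostCopyAt w u → nth w t ≡ nth w u → t ≡ u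
leftmostCopy-unique w {t} {u} lcₜ lcᵤ wₜ≡wᵤ with <-cmp t u
... | tri< t<u _ _ = ⊥-elim (lcᵤ t t<u wₜ≡wᵤ)
... | tri≈ _ t≡u _ = t≡u
... | tri> _ _ u<t = ⊥-elim (lcₜ u u<t (sym wₜ≡wᵤ))

reduce : Word → Word
reduce w = Ranks.ranks (leftmostCopy? w) w

module _ (w : Word) where

  open Ranks (leftmostCopy? w) w

  private
    dominated : Dominated
    dominated s<n = let t , t≤s , wₜ≡wₛ , lc = firstCopy w s<n in t , ≤-<-trans t≤s s<n , lc , ≤-reflexive wₜ≡wₛ

    separated : Separated
    separated s<n t<n wₛ<wₜ =
      let u , u≤t , wᵤ≡wₜ , lc = firstCopy w t<n
      in  u , ≤-<-trans u≤t t<n , lc , subst (_ <_) (sym wᵤ≡wₜ) wₛ<wₜ , ≤-reflexive wᵤ≡wₜ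

  reduce-SamePattern : SamePattern w (reduce w)
  reduce-SamePattern = ranks-SamePattern separated

  reduce-isCayley : (∀ {s} → s < length w → 1 ≤ nth w s) → ∀ {B} → (∀ {s} → s < length w → nth w s ≤ B) →
    IsCayley (reduce w)
  reduce-isCayley = ranks-isCayley dominated (λ _ _ → leftmostCopy-unique w)

Cayley⇒≡reduce : ∀ {x} → IsCayley x → x ≡ reduce x
Cayley⇒≡reduce {x} cx = Cayley-≡ cx (reduce-isCayley x X.positive X.bounded) (proj₁ (reduce-SamePattern x))
  (λ s<n t<n → proj₁ (proj₂ (reduce-SamePattern x) _ _ (toR s<n) (toR t<n)))
  where
  module X = Cayley cx
  toR : ∀ {i} → i < length x → i < length (reduce x)
  toR = subst (_ <_) (proj₁ (reduce-SamePattern x))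

Contains-st : ∀ {x p} → IsCayley x → IsPerm p → Contains (st x) p → ∃[ y ] (IsCayley y × st y ≡ p × Contains x y)
Contains-st {x} {p} cx (cp , _) (z , σ , z≈p@(lz≡lp , same)) =
  y , cy , Cayley-≡ (proj₁ (st-isPerm y)) cp lsty≡lp order , w , select-⊆ σ x (length-st x) , w≈y
  where
  open Related.EquationalReasoning
  module X = Cayley cx
  e = ⊆-index σ
  w = select σ x
  y = reduce w
  w≈y = reduce-SamePattern w
  lw≡lz : length w ≡ length z
  lw≡lz = length-select σ x (length-st x)
  wₛ≡ : ∀ {s} → s < length z → nth w s ≡ nth x (e s)
  wₛ≡ = nth-select σ x (length-st x)
  e-< : ∀ {s} → s < length z → e s < length x
  e-< s<n = <-length-st x (⊆-index-< σ s<n)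
  cy : IsCayley y
  cy = reduce-isCayley w
    (λ s<n → let s<z = subst (_ <_) lw≡lz s<n in subst (1 ≤_) (sym (wₛ≡ s<z)) (X.positive (e-< s<z)))
    (λ s<n → let s<z = subst (_ <_) lw≡lz s<n in subst (_≤ X.maxValue) (sym (wₛ≡ s<z)) (X.bounded (e-< s<z)))
  lsty≡lp : length (st y) ≡ length p
  lsty≡lp = trans (length-st y) (trans (sym (proj₁ w≈y)) (trans lw≡lz lz≡lp))
  order : ∀ {s t} → s < length (st y) → t < length (st y) → nth (st y) s < nth (st y) t ⇔ nth p s < nth p t
  order {s} {t} s<n t<n = begin
    nth (st y) s < nth (st y) t                 ∼⟨ st-<⇔≺ y s<y t<y ⟩
    s ≺⟨ y ⟩ t                                  ∼⟨ ⇔-sym (≺-SamePattern {w} {y} w≈y s<y t<y) ⟩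
    s ≺⟨ w ⟩ t                                  ∼⟨ ≺-reindex σ w x wₛ≡ s<z t<z ⟩
    e s ≺⟨ x ⟩ e t                              ∼⟨ ⇔-sym (st-<⇔≺ x (e-< s<z) (e-< t<z)) ⟩
    nth (st x) (e s) < nth (st x) (e t)         ≡⟨ cong₂ _<_ (nth-⊆-index σ s<z) (nth-⊆-index σ t<z) ⟨
    nth z s < nth z t                           ∼⟨ proj₁ (same s t (subst (_ <_) lz≡lp s<z) (subst (_ <_) lz≡lp t<z)) ⟩
    nth p s < nth p t                           ∎
    where
    s<y = <-length-st y s<n
    t<y = <-length-st y t<n
    s<z = subst (_ <_) (trans (sym (proj₁ w≈y)) lw≡lz) s<y
    t<z = subst (_ <_) (trans (sym (proj₁ w≈y)) lw≡lz) t<y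

-- Standardizations of modified ascent sequences lie in Ω

modAsc-head≡1 : ∀ {x} → IsModAsc x → 0 < length x → nth x 0 ≡ 1
modAsc-head≡1 {x} (cx , asc⇔lc) 0<n
  with i , i<n , xᵢ≡1 ← Cayley.onto cx ≤-refl (≤-trans (Cayley.positive cx 0<n) (Cayley.bounded cx 0<n))
  with firstCopy x i<n
... | zero  , _ , x₀≡xᵢ , _ = trans x₀≡xᵢ xᵢ≡1
... | suc t , t<i , xₜ≡xᵢ , lc =
  ⊥-elim (<⇒≱ (subst (nth x t <_) (trans xₜ≡xᵢ xᵢ≡1) (from (asc⇔lc (suc t) 1+t<n) lc))
              (Cayley.positive cx (<-trans (n<1+n t) 1+t<n)))
  where 1+t<n = ≤-<-trans t<i i<n

countLess≡0 : ∀ {a} x → (∀ {i} → i < length x → a ≤ nth x i) → countLess a x ≡ 0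
countLess≡0     []      _   = refl
countLess≡0 {a} (v ∷ x) a≤x rewrite filter-reject (_<? a) {xs = x} (λ v<a → <⇒≱ v<a (a≤x z<s)) =
  countLess≡0 x (a≤x ∘ s<s)

st-head≡1 : ∀ {x} → IsModAsc x → length (st x) ≡ 0 ⊎ nth (st x) 0 ≡ 1
st-head≡1 {[]}    _          = inj₁ refl
st-head≡1 {v ∷ x} mx@(cx , _) = inj₂ (begin
  nth (st (v ∷ x)) 0         ≡⟨ nth-st (v ∷ x) z<s ⟩
  countLess v (v ∷ x) + 1    ≡⟨ cong (λ a → countLess a (v ∷ x) + 1) (modAsc-head≡1 mx z<s) ⟩
  countLess 1 (v ∷ x) + 1    ≡⟨ cong (_+ 1) (countLess≡0 (v ∷ x) (Cayley.positive cx)) ⟩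
  1                          ∎)
  where open ≡-Reasoning

st-<-leftward : ∀ x {i j} → i < j → j < length x → nth (st x) j < nth (st x) i → nth x j < nth x i
st-<-leftward x i<j j<n stⱼ<stᵢ with to (st-<⇔≺ x j<n (<-trans i<j j<n)) stⱼ<stᵢ
... | inj₁ xⱼ<xᵢ      = xⱼ<xᵢ
... | inj₂ (_ , j<i) = ⊥-elim (<-asym i<j j<i)

-- The leftmost copy of x_{i+1} is an ascent top, so it lies strictly left of the
-- descent bottom i + 1, and its standardized value falls strictly between st_j
-- and st_{i+1} = st_j + 1.
st-avoids-Ω-pattern : ∀ {x} → IsModAsc x → ∀ i j → suc i < j → j < length (st x) →
  ¬ (nth (st x) i > nth (st x) (suc i) × nth (st x) (suc i) ≡ suc (nth (st x) j))
st-avoids-Ω-pattern {x} (_ , asc⇔lc) i j 1+i<j j<n′ = no-pattern (<-length-st x j<n′) (<-trans 1+i<j (<-length-st x j<n′))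
  where
  no-pattern : j < length x → suc i < length x →
    ¬ (nth (st x) i > nth (st x) (suc i) × nth (st x) (suc i) ≡ suc (nth (st x) j))
  no-pattern j<n 1+i<n (stᵢ₊₁<stᵢ , stᵢ₊₁≡1+stⱼ) with firstCopy x 1+i<n
  ... | t , t≤1+i , xₜ≡xᵢ₊₁ , lc with m≤n⇒m<n∨m≡n t≤1+i
  ...   | inj₂ refl = <-asym (st-<-leftward x (n<1+n i) 1+i<n stᵢ₊₁<stᵢ) (from (asc⇔lc (suc i) 1+i<n) lc)
  ...   | inj₁ t<1+i = <⇒≱ stⱼ<stₜ (s≤s⁻¹ (subst (nth (st x) t <_) stᵢ₊₁≡1+stⱼ stₜ<stᵢ₊₁))
    where
    stₜ<stᵢ₊₁ = st-<-tie x t<1+i 1+i<n xₜ≡xᵢ₊₁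
    xⱼ<xᵢ₊₁ = st-<-leftward x 1+i<j j<n (subst (nth (st x) j <_) (sym stᵢ₊₁≡1+stⱼ) ≤-refl)
    stⱼ<stₜ = st-<-value x j<n (<-trans t<1+i 1+i<n) (subst (nth x j <_) (sym xₜ≡xᵢ₊₁) xⱼ<xᵢ₊₁)

st-InΩ : ∀ {x} → IsModAsc x → InΩ (st x)
st-InΩ {x} mx = st-isPerm x , st-head≡1 mx , st-avoids-Ω-pattern mx

-- Recovering a primitive modified ascent sequence from its standardization

ascentTop? : ∀ q → Decidable (AscentTopAt q)
ascentTop? q zero    = yes tt
ascentTop? q (suc i) = nth q i <? nth q (suc i)

st⁻¹ : Word → Word
st⁻¹ q = Ranks.ranks (ascentTop? q) q

st-AscentTop⇔ : ∀ {x} → IsPrimitive x → ∀ {t} → t < length x → AscentTopAt x t ⇔ AscentTopAt (st x) t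
st-AscentTop⇔     prim {zero}  _     = mk⇔ (λ _ → tt) (λ _ → tt)
st-AscentTop⇔ {x} prim {suc t} 1+t<n = mk⇔ (st-<-value x t<n 1+t<n) reflect
  where
  t<n = <-trans (n<1+n t) 1+t<n
  reflect : nth (st x) t < nth (st x) (suc t) → nth x t < nth x (suc t)
  reflect stₜ<stₜ₊₁ with to (st-<⇔≺ x t<n 1+t<n) stₜ<stₜ₊₁
  ... | inj₁ xₜ<xₜ₊₁     = xₜ<xₜ₊₁
  ... | inj₂ (xₜ≡xₜ₊₁ , _) = ⊥-elim (prim t 1+t<n xₜ≡xₜ₊₁)

leftmostCopy-≤⇔ : ∀ x {t i} → LeftmostCopyAt x t → t < length x → i < length x →
  nth x t ≤ nth x i ⇔ nth (st x) t ≤ nth (st x) i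
leftmostCopy-≤⇔ x {t} {i} lc t<n i<n = mk⇔ preserve reflect
  where
  preserve : nth x t ≤ nth x i → nth (st x) t ≤ nth (st x) i
  preserve xₜ≤xᵢ with m≤n⇒m<n∨m≡n xₜ≤xᵢ | <-cmp t i
  ... | inj₁ xₜ<xᵢ | _            = <⇒≤ (st-<-value x t<n i<n xₜ<xᵢ)
  ... | inj₂ xₜ≡xᵢ | tri< t<i _ _ = <⇒≤ (st-<-tie x t<i i<n xₜ≡xᵢ)
  ... | inj₂ _     | tri≈ _ t≡i _ = ≤-reflexive (cong (nth (st x)) t≡i)
  ... | inj₂ xₜ≡xᵢ | tri> _ _ i<t = ⊥-elim (lc i i<t (sym xₜ≡xᵢ))
  reflect : nth (st x) t ≤ nth (st x) i → nth x t ≤ nth x i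
  reflect stₜ≤stᵢ = ≮⇒≥ (λ xᵢ<xₜ → <⇒≱ (st-<-value x i<n t<n xᵢ<xₜ) stₜ≤stᵢ)

st⁻¹-st : ∀ {x} → IsModAsc x → IsPrimitive x → st⁻¹ (st x) ≡ x
st⁻¹-st {x} (cx , asc⇔lc) prim =
  sym (trans (Cayley⇒≡reduce cx) (nth-extensional (reduce x) (st⁻¹ (st x)) lengths pointwise))
  where
  module LC = Ranks (leftmostCopy? x) x
  module AT = Ranks (ascentTop? (st x)) (st x)
  lengths : length (reduce x) ≡ length (st⁻¹ (st x))
  lengths = trans LC.length-ranks (trans (sym (length-st x)) (sym AT.length-ranks))
  pointwise : ∀ i → i < length (reduce x) → nth (reduce x) i ≡ nth (st⁻¹ (st x)) i
  pointwise i i<n′ = begin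
    nth (reduce x) i                             ≡⟨ LC.nth-ranks i<n ⟩
    count (LC.atMost (nth x i)) (length x)       ≡⟨ count-cong (LC.atMost (nth x i)) (AT.atMost (nth (st x) i)) (length x) same ⟩
    count (AT.atMost (nth (st x) i)) (length x)  ≡⟨ cong (count (AT.atMost (nth (st x) i))) (length-st x) ⟨
    AT.rank (nth (st x) i)                       ≡⟨ AT.nth-ranks (subst (i <_) (sym (length-st x)) i<n) ⟨
    nth (st⁻¹ (st x)) i                          ∎
    where
    open ≡-Reasoning
    i<n = subst (i <_) LC.length-ranks i<n′
    same : ∀ {t} → t < length x →
      (LeftmostCopyAt x t × nth x t ≤ nth x i) ⇔ (AscentTopAt (st x) t × nth (st x) t ≤ nth (st x) i)
    same t<n = mk⇔
      (λ (lc , xₜ≤xᵢ) → to (st-AscentTop⇔ prim t<n) (from (asc⇔lc _ t<n) lc)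
                      , to (leftmostCopy-≤⇔ x lc t<n i<n) xₜ≤xᵢ)
      (λ (at , stₜ≤stᵢ) → let lc = to (asc⇔lc _ t<n) (from (st-AscentTop⇔ prim t<n) at)
                          in  lc , from (leftmostCopy-≤⇔ x lc t<n i<n) stₜ≤stᵢ)

-- Every element of Ω is a standardization

module FromΩ {q : Word} (qΩ : InΩ q) where

  open Ranks (ascentTop? q) q

  private
    module Q = Cayley (proj₁ (proj₁ qΩ))

  q-injective : NthInjective q
  q-injective = Unique⇒nth-injective q (proj₂ (proj₁ qΩ))

  q-head : 0 < n → nth q 0 ≡ 1
  q-head 0<n with proj₁ (proj₂ qΩ)
  ... | inj₁ n≡0  = ⊥-elim (<-irrefl (sym n≡0) 0<n)
  ... | inj₂ q₀≡1 = q₀≡1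

  predecessor-before : ∀ {j m} → suc j < n → m < n → nth q j > nth q (suc j) → nth q (suc j) ≡ suc (nth q m) → m < j
  predecessor-before {j} {m} 1+j<n m<n descent qⱼ₊₁≡1+qₘ with <-cmp m j
  ... | tri< m<j _ _ = m<j
  ... | tri≈ _ refl _ = ⊥-elim (<-asym descent (subst (nth q m <_) (sym qⱼ₊₁≡1+qₘ) ≤-refl))
  ... | tri> _ _ j<m with m≤n⇒m<n∨m≡n j<m
  ...   | inj₁ 1+j<m  = ⊥-elim (proj₂ (proj₂ qΩ) j m 1+j<m m<n (descent , qⱼ₊₁≡1+qₘ))
  ...   | inj₂ refl   = ⊥-elim (1+n≢n (sym qⱼ₊₁≡1+qₘ))

  rank-<-ascentTop : ∀ {s t} → t < n → AscentTopAt q t → nth q s < nth q t → rank (nth q s) < rank (nth q t)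
  rank-<-ascentTop t<n at qₛ<qₜ = rank-mono-< t<n at qₛ<qₜ ≤-refl

  rank-tie-below : ∀ {j m} → j < n → m < n → nth q j ≡ suc (nth q m) → rank (nth q m) ≡ rank (nth q j) → suc m < j
  rank-tie-below {zero} {m} 0<n _ qⱼ≡1+qₘ tie =
    ⊥-elim (<-irrefl tie (rank-<-ascentTop 0<n tt (subst (nth q m <_) (sym qⱼ≡1+qₘ) ≤-refl)))
  rank-tie-below {suc j} {m} 1+j<n m<n qⱼ₊₁≡1+qₘ tie with nth q j <? nth q (suc j)
  ... | yes at = ⊥-elim (<-irrefl tie (rank-<-ascentTop 1+j<n at (subst (nth q m <_) (sym qⱼ₊₁≡1+qₘ) ≤-refl)))
  ... | no ¬at = s<s (predecessor-before 1+j<n m<n descent qⱼ₊₁≡1+qₘ)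
    where
    descent : nth q j > nth q (suc j)
    descent = ≤∧≢⇒< (≮⇒≥ ¬at)
      (λ qⱼ₊₁≡qⱼ → 1+n≢n (q-injective 1+j<n (<-trans (n<1+n j) 1+j<n) qⱼ₊₁≡qⱼ))

  -- Induction on the gap between q_i and q_j: the value just below q_j sits
  -- before j and still ties with q_i.
  rank-tie⇒< : ∀ d {i j} → i < n → j < n → nth q j ≡ suc (d + nth q i) → rank (nth q i) ≡ rank (nth q j) → i < j
  rank-tie⇒< zero    i<n j<n qⱼ≡ tie = <-trans (n<1+n _) (rank-tie-below j<n i<n qⱼ≡ tie)
  rank-tie⇒< (suc d) {i} {j} i<n j<n qⱼ≡ tie =
    let m , m<n , qⱼ≡1+qₘ = Q.predecessor j<n (subst (1 <_) (sym qⱼ≡) (s≤s (≤-trans (Q.positive i<n) (m≤n+m _ (suc d)))))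
        qₘ≡ = suc-injective (trans (sym qⱼ≡1+qₘ) qⱼ≡)
        tieₘ = ≤-antisym (rank-mono (≤-trans (n≤1+n _) (≤-reflexive (sym qⱼ≡1+qₘ))))
                         (subst (_≤ rank (nth q m)) tie (rank-mono (subst (nth q i ≤_) (sym qₘ≡) (m≤n+m _ (suc d)))))
    in  <-trans (rank-tie⇒< d i<n m<n qₘ≡ (trans tie (sym tieₘ))) (<-trans (n<1+n _) (rank-tie-below j<n m<n qⱼ≡1+qₘ tieₘ))

  rank-tie⇒<′ : ∀ {i j} → i < n → j < n → nth q i < nth q j → rank (nth q i) ≡ rank (nth q j) → i < j
  rank-tie⇒<′ {i} {j} i<n j<n qᵢ<qⱼ = rank-tie⇒< (nth q j ∸ suc (nth q i)) i<n j<n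
    (sym (trans (sym (+-suc _ (nth q i))) (m∸n+n≡m qᵢ<qⱼ)))

  x : Word
  x = st⁻¹ q

  length-x : length x ≡ n
  length-x = length-ranks

  <⇔≺ : ∀ {i j} → i < n → j < n → nth q i < nth q j ⇔ i ≺⟨ x ⟩ j
  <⇔≺ {i} {j} i<n j<n rewrite nth-ranks i<n | nth-ranks j<n = mk⇔ preserve reflect
    where
    preserve : nth q i < nth q j → rank (nth q i) < rank (nth q j) ⊎ (rank (nth q i) ≡ rank (nth q j) × i < j)
    preserve qᵢ<qⱼ with m≤n⇒m<n∨m≡n (rank-mono (<⇒≤ qᵢ<qⱼ))
    ... | inj₁ rᵢ<rⱼ = inj₁ rᵢ<rⱼ
    ... | inj₂ rᵢ≡rⱼ = inj₂ (rᵢ≡rⱼ , rank-tie⇒<′ i<n j<n qᵢ<qⱼ rᵢ≡rⱼ)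
    reflect : rank (nth q i) < rank (nth q j) ⊎ (rank (nth q i) ≡ rank (nth q j) × i < j) → nth q i < nth q j
    reflect i≺j with <-cmp (nth q i) (nth q j) | i≺j
    ... | tri< qᵢ<qⱼ _ _ | _                  = qᵢ<qⱼ
    ... | tri≈ _ qᵢ≡qⱼ _ | inj₁ rᵢ<rⱼ         = ⊥-elim (<-irrefl (cong rank qᵢ≡qⱼ) rᵢ<rⱼ)
    ... | tri≈ _ qᵢ≡qⱼ _ | inj₂ (_ , i<j)     = ⊥-elim (<-irrefl (q-injective i<n j<n qᵢ≡qⱼ) i<j)
    ... | tri> _ _ qⱼ<qᵢ | inj₁ rᵢ<rⱼ         = ⊥-elim (<⇒≱ rᵢ<rⱼ (rank-mono (<⇒≤ qⱼ<qᵢ)))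
    ... | tri> _ _ qⱼ<qᵢ | inj₂ (rᵢ≡rⱼ , i<j) = ⊥-elim (<-asym i<j (rank-tie⇒<′ j<n i<n qⱼ<qᵢ (sym rᵢ≡rⱼ)))

  st-x : st x ≡ q
  st-x = Cayley-≡ (proj₁ (st-isPerm x)) (proj₁ (proj₁ qΩ)) (trans (length-st x) length-x) λ {s} {t} s<n t<n →
    let s<x = <-length-st x s<n
        t<x = <-length-st x t<n
    in  ⇔-trans (st-<⇔≺ x s<x t<x) (⇔-sym (<⇔≺ (subst (_ <_) length-x s<x) (subst (_ <_) length-x t<x)))

  x-isCayley : IsCayley x
  x-isCayley = ranks-isCayley dominated (λ t<n u<n _ _ → q-injective t<n u<n) Q.positive Q.bounded
    where
    dominated : Dominated
    dominated s<n = 0 , ≤-<-trans z≤n s<n , tt , subst (_≤ nth q _) (sym (q-head (≤-<-trans z≤n s<n))) (Q.positive s<n)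

  private
    x-tie : ∀ {s t} → s < n → t < n → nth x s ≡ nth x t → rank (nth q s) ≡ rank (nth q t)
    x-tie s<n t<n xₛ≡xₜ = trans (sym (nth-ranks s<n)) (trans xₛ≡xₜ (nth-ranks t<n))

  x-AscentTop⇔ : ∀ {t} → t < n → AscentTopAt x t ⇔ AscentTopAt q t
  x-AscentTop⇔ {zero}  _     = mk⇔ (λ _ → tt) (λ _ → tt)
  x-AscentTop⇔ {suc t} 1+t<n = mk⇔
    (λ xₜ<xₜ₊₁ → from (<⇔≺ t<n 1+t<n) (inj₁ xₜ<xₜ₊₁))
    (λ qₜ<qₜ₊₁ → subst₂ _<_ (sym (nth-ranks t<n)) (sym (nth-ranks 1+t<n))
                   (rank-<-ascentTop 1+t<n qₜ<qₜ₊₁ qₜ<qₜ₊₁))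
    where t<n = <-trans (n<1+n t) 1+t<n

  -- The position of q_{m+1} - 1 lies left of a descent bottom m + 1 because q
  -- avoids the pattern of Ω, and no ascent top separates the two values.
  descent-tie : ∀ {m} → suc m < n → ¬ AscentTopAt q (suc m) → ∃[ u ] (u < m × nth x u ≡ nth x (suc m))
  descent-tie {m} 1+m<n ¬at =
    let u , u<n , qₘ₊₁≡1+qᵤ = Q.predecessor 1+m<n 1<qₘ₊₁
    in  u , predecessor-before 1+m<n u<n descent qₘ₊₁≡1+qᵤ , tie u<n qₘ₊₁≡1+qᵤ
    where
    m<n = <-trans (n<1+n m) 1+m<n
    0<n = ≤-<-trans z≤n m<n
    descent : nth q m > nth q (suc m)
    descent = ≤∧≢⇒< (≮⇒≥ ¬at) (λ qₘ₊₁≡qₘ → 1+n≢n (q-injective 1+m<n m<n qₘ₊₁≡qₘ))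
    1<qₘ₊₁ : 1 < nth q (suc m)
    1<qₘ₊₁ = ≤∧≢⇒< (Q.positive 1+m<n)
      (λ 1≡qₘ₊₁ → 1+n≢0 (q-injective 1+m<n 0<n (trans (sym 1≡qₘ₊₁) (sym (q-head 0<n)))))
    tie : ∀ {u} → u < n → nth q (suc m) ≡ suc (nth q u) → nth x u ≡ nth x (suc m)
    tie {u} u<n qₘ₊₁≡1+qᵤ = begin
      nth x u                  ≡⟨ nth-ranks u<n ⟩
      rank (nth q u)           ≡⟨ rank-skip (λ t<n at qₜ≡1+qᵤ → ¬at (subst (AscentTopAt q)
                                    (q-injective t<n 1+m<n (trans qₜ≡1+qᵤ (sym qₘ₊₁≡1+qᵤ))) at)) ⟨
      rank (suc (nth q u))     ≡⟨ cong rank qₘ₊₁≡1+qᵤ ⟨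
      rank (nth q (suc m))     ≡⟨ nth-ranks 1+m<n ⟨
      nth x (suc m)            ∎
      where open ≡-Reasoning

  ascentTop⇒leftmostCopy : ∀ {t} → t < n → AscentTopAt q t → LeftmostCopyAt x t
  ascentTop⇒leftmostCopy {t} t<n at j j<t xⱼ≡xₜ with <-cmp (nth q j) (nth q t)
  ... | tri< qⱼ<qₜ _ _ = <-irrefl (x-tie (<-trans j<t t<n) t<n xⱼ≡xₜ) (rank-<-ascentTop t<n at qⱼ<qₜ)
  ... | tri≈ _ qⱼ≡qₜ _ = <-irrefl (q-injective (<-trans j<t t<n) t<n qⱼ≡qₜ) j<t
  ... | tri> _ _ qₜ<qⱼ = <-asym j<t (rank-tie⇒<′ t<n (<-trans j<t t<n) qₜ<qⱼ (sym (x-tie (<-trans j<t t<n) t<n xⱼ≡xₜ)))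

  leftmostCopy⇒ascentTop : ∀ {t} → t < n → LeftmostCopyAt x t → AscentTopAt q t
  leftmostCopy⇒ascentTop {zero}  _     _  = tt
  leftmostCopy⇒ascentTop {suc m} 1+m<n lc with ascentTop? q (suc m)
  ... | yes at = at
  ... | no ¬at = let u , u<m , xᵤ≡xₘ₊₁ = descent-tie 1+m<n ¬at in ⊥-elim (lc u (<-trans u<m (n<1+n m)) xᵤ≡xₘ₊₁)

  x-isModAsc : IsModAsc x
  x-isModAsc = x-isCayley , λ t t<n′ → let t<n = subst (t <_) length-x t<n′ in
    mk⇔ (ascentTop⇒leftmostCopy t<n ∘ to (x-AscentTop⇔ t<n)) (from (x-AscentTop⇔ t<n) ∘ leftmostCopy⇒ascentTop t<n)

  x-isPrimitive : IsPrimitive x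
  x-isPrimitive i 1+i<n′ xᵢ≡xᵢ₊₁ = no-tie (x-tie i<n 1+i<n xᵢ≡xᵢ₊₁)
    where
    1+i<n = subst (_ <_) length-x 1+i<n′
    i<n = <-trans (n<1+n i) 1+i<n
    no-tie : rank (nth q i) ≢ rank (nth q (suc i))
    no-tie tie with <-cmp (nth q i) (nth q (suc i))
    ... | tri< qᵢ<qᵢ₊₁ _ _ = <-irrefl tie (rank-<-ascentTop 1+i<n qᵢ<qᵢ₊₁ qᵢ<qᵢ₊₁)
    ... | tri≈ _ qᵢ≡qᵢ₊₁ _ = 1+n≢n (sym (q-injective i<n 1+i<n qᵢ≡qᵢ₊₁))
    ... | tri> _ _ qᵢ₊₁<qᵢ = <-asym (n<1+n i) (rank-tie⇒<′ 1+i<n i<n qᵢ₊₁<qᵢ (sym tie))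

  x-InPrim : ∀ {p} → Avoids q p → InPrim p x
  x-InPrim q-avoids = x-isModAsc , x-isPrimitive ,
    λ y _ sty≡p x⊇y → q-avoids (subst₂ Contains st-x sty≡p (st-Contains x y x⊇y))

st-InΩof : ∀ {p x} → IsPerm p → InPrim p x → InΩof p (st x)
st-InΩof pp (mx , _ , x-avoids) = st-InΩ mx , λ stx⊇p →
  let y , cy , sty≡p , x⊇y = Contains-st (proj₁ mx) pp stx⊇p in x-avoids y cy sty≡p x⊇y

theorem3p8 : ∀ (p : Word) → IsPerm p →
    ((∀ x → InPrim p x → InΩof p (st x) × length (st x) ≡ length x)
    × (∀ x y → InPrim p x → InPrim p y → st x ≡ st y → x ≡ y)
    × (∀ q → InΩof p q → ∃[ x ] (InPrim p x × st x ≡ q)))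
theorem3p8 p pp =
    (λ x x∈Prim → st-InΩof pp x∈Prim , length-st x)
  , (λ x y (mx , px , _) (my , py , _) stx≡sty →
       trans (sym (st⁻¹-st mx px)) (trans (cong st⁻¹ stx≡sty) (st⁻¹-st my py)))
  , (λ q (qΩ , q-avoids) → st⁻¹ q , FromΩ.x-InPrim qΩ q-avoids , FromΩ.st-x qΩ)
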